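{- Let $n \geq k+1$ be positive integers such that $k \leq \lfloor n/2 \rfloor$. Then $\mathrm{Spec}(P_n, k)=\{2, 3, \ldots, k+1\}$.
   Context: $P_n$ is the path on $n$ vertices $v_1,\dots,v_n$ (in order), with graph distance $\mathrm{dist}(v_i,v_j)=|i-j|$; its diameter is $n-1$. For a set $D$ of positive integers, the distance graph $G(P_n,D)$ has vertex set $\{v_1,\dots,v_n\}$, with $v_i,v_j$ ($i\ne j$) adjacent iff $|i-j|\in D$; $\chi(P_n,D)$ is its chromatic number. The Babai $k$-spectrum is $\mathrm{Spec}(P_n,k)=\{\chi(P_n,D): D\subseteq\{1,2,\dots,n-1\},\ |D|=k\}$. -}

module Defs where

open import Data.Nat using (ℕ; suc; _≤_; _∸_; ∣_-_∣)
open import Data.Fin using (Fin; toℕ)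
open import Data.List using (List; length)
open import Data.List.Membership.Propositional using (_∈_)
open import Data.List.Relation.Unary.All using (All)
open import Data.List.Relation.Unary.Unique.Propositional using (Unique)
open import Data.Product using (Σ; _×_)
open import Relation.Binary.PropositionalEquality using (_≡_; _≢_)
open import Relation.Nullary using (¬_)

-- Vertices of P_n: v_{i+1} is represented by i : Fin n, so dist(v_i,v_j) = |i - j|.
pathDist : {n : ℕ} → Fin n → Fin n → ℕ
pathDist i j = ∣ toℕ i - toℕ j ∣

-- Adjacency in the distance graph G(P_n, D)  (i ≠ j is implied since 0 ∉ D
-- for the admissible D considered below; we add it explicitly anyway).
Adj : {n : ℕ} → List ℕ → Fin n → Fin n → Set
Adj D i j = (toℕ i ≢ toℕ j) × (pathDist i j ∈ D)

ProperColouring : (n : ℕ) → List ℕ → (c : ℕ) → (Fin n → Fin c) → Set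
ProperColouring n D c f = ∀ (i j : Fin n) → Adj D i j → f i ≢ f j

Colourable : (n : ℕ) → List ℕ → ℕ → Set
Colourable n D c = Σ (Fin n → Fin c) (ProperColouring n D c)

IsChromaticNumber : (n : ℕ) → List ℕ → ℕ → Set
IsChromaticNumber n D m = Colourable n D m × (∀ c → suc c ≤ m → ¬ Colourable n D c)

AdmissibleDistanceSet : (n k : ℕ) → List ℕ → Set
AdmissibleDistanceSet n k D =
  Unique D × (length D ≡ k) × All (λ d → 1 ≤ d × d ≤ n ∸ 1) D

InSpec : (n k m : ℕ) → Set
InSpec n k m = Σ (List ℕ) (λ D → AdmissibleDistanceSet n k D × IsChromaticNumber n D m)

-- Greedy colouring in the order v₁, v₂, … uses at most |D| + 1 colours, because every vertex
-- has at most |D| earlier neighbours; and a single edge already forces two colours.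
-- Conversely, for 2 ≤ q ≤ k + 1 let D consist of the first k positive integers not divisible
-- by q. Colouring by residues mod q is proper, while 1, …, q − 1 ∈ D turn the first q vertices
-- into a clique, so χ(P_n, D) = q. The j-th element of D is at most 2j − 1 ≤ 2k − 1, which is
-- where k ≤ ⌊n/2⌋ is needed to keep D ⊆ {1, …, n − 1}.
module Submission where

open import Defs
open import Data.Nat
  using (ℕ; zero; suc; _≤_; _<_; _+_; _*_; _∸_; ∣_-_∣; s≤s; s≤s⁻¹; z<s; ⌊_/2⌋; NonZero)
open import Data.Nat.Properties
open import Data.Nat.DivMod using (_/_; _%_; m≡m%n+[m/n]*n; m%n<n; m/n≤m; /-monoˡ-≤; m<n⇒m/n≡0)
open import Data.Nat.Divisibility using (_∣_; _∤_; divides; ∣m+n∣m⇒∣n; n∣m*n; ∣⇒≤)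
open import Data.Nat.Solver using (module +-*-Solver)
open import Data.Fin as Fin using (Fin; toℕ; fromℕ<; inject≤)
import Data.Fin.Properties as Fin
open import Data.List using (List; []; _∷_; length; map; applyUpTo; lookup)
open import Data.List.Properties using (length-map; length-applyUpTo)
open import Data.List.Membership.Propositional using (_∈_; _∉_)
open import Data.List.Membership.Propositional.Properties using (∈-map⁺; ∈-applyUpTo⁺; ∈-applyUpTo⁻)
import Data.List.Membership.DecPropositional as DecMembership
open import Data.List.Relation.Unary.All using (_∷_)
import Data.List.Relation.Unary.All.Properties as All
open import Data.List.Relation.Unary.Any using (index; here)
open import Data.List.Relation.Unary.Any.Properties using (lookup-index)
import Data.List.Relation.Unary.Unique.Propositional.Properties as Unique
open import Data.Product using (∃; _×_; _,_)
open import Data.Sum using (inj₁; inj₂)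
open import Data.Empty using (⊥-elim)
open import Function using (_∘_)
open import Function.Bundles using (_⇔_; mk⇔)
open import Relation.Binary using (tri<; tri≈; tri>)
open import Relation.Binary.PropositionalEquality
open import Relation.Nullary using (¬_; yes; no)

length<⇒∃∉ : ∀ {c} (L : List (Fin c)) → length L < c → ∃ λ x → x ∉ L
length<⇒∃∉ {c} L len<c = Fin.¬∀⟶∃¬ c (_∈ L) (_∈? L) ¬covered
  where
  open DecMembership (Fin._≟_ {c}) using (_∈?_)
  ¬covered : ¬ (∀ x → x ∈ L)
  ¬covered covered =
    let a , b , a<b , same = Fin.pigeonhole len<c (index ∘ covered)
    in Fin.<⇒≢ a<b (begin
         a                                ≡⟨ lookup-index (covered a) ⟩
         lookup L (index (covered a))     ≡⟨ cong (lookup L) same ⟩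
         lookup L (index (covered b))     ≡⟨ lookup-index (covered b) ⟨
         b                                ∎)
    where open ≡-Reasoning

_[_]≔_ : {A : Set} → (ℕ → A) → ℕ → A → ℕ → A
(f [ N ]≔ x) i with i ≟ N
... | yes _ = x
... | no  _ = f i

[]≔-updated : ∀ {A : Set} (f : ℕ → A) N x → (f [ N ]≔ x) N ≡ x
[]≔-updated f N x with N ≟ N
... | yes _   = refl
... | no  N≢N = ⊥-elim (N≢N refl)

[]≔-other : ∀ {A : Set} (f : ℕ → A) {N} x {i} → i ≢ N → (f [ N ]≔ x) i ≡ f i
[]≔-other f {N} x {i} i≢N with i ≟ N
... | yes i≡N = ⊥-elim (i≢N i≡N)
... | no  _   = refl

ProperBelow : List ℕ → ℕ → {c : ℕ} → (ℕ → Fin c) → Set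
ProperBelow D N f = ∀ {i j} → i < j → j < N → j ∸ i ∈ D → f i ≢ f j

-- Contains the colour of every earlier neighbour of N (and, for d > N, the harmless junk f 0).
earlierNeighbourColours : {A : Set} → List ℕ → ℕ → (ℕ → A) → List A
earlierNeighbourColours D N f = map (λ d → f (N ∸ d)) D

ProperBelow-extend : ∀ {D N c} {f : ℕ → Fin c} {x} → ProperBelow D N f →
                     x ∉ earlierNeighbourColours D N f → ProperBelow D (suc N) (f [ N ]≔ x)
ProperBelow-extend {D} {f = f} {x} proper x∉ {i} {j} i<j j<1+N j∸i∈D same
  with m≤n⇒m<n∨m≡n (s≤s⁻¹ j<1+N)
... | inj₁ j<N = proper i<j j<N j∸i∈D
  (trans (sym ([]≔-other f x (<⇒≢ (<-trans i<j j<N)))) (trans same ([]≔-other f x (<⇒≢ j<N))))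
... | inj₂ refl = x∉ (subst (_∈ _) fi≡x earlier)
  where
  fi≡x : f i ≡ x
  fi≡x = trans (sym ([]≔-other f x (<⇒≢ i<j))) (trans same ([]≔-updated f j x))
  earlier : f i ∈ earlierNeighbourColours D j f
  earlier = subst (_∈ earlierNeighbourColours D j f) (cong f (m∸[m∸n]≡n (<⇒≤ i<j)))
                  (∈-map⁺ (λ d → f (j ∸ d)) j∸i∈D)

greedyColouring : ∀ D N → ∃ (ProperBelow D N {suc (length D)})
greedyColouring D zero    = (λ _ → Fin.zero) , λ _ ()
greedyColouring D (suc N) =
  let f , proper = greedyColouring D N
      x , x∉     = length<⇒∃∉ (earlierNeighbourColours D N f) (s≤s (≤-reflexive (length-map _ D)))
  in f [ N ]≔ x , ProperBelow-extend proper x∉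

ProperBelow⇒ProperColouring : ∀ {n D c} {f : ℕ → Fin c} →
                              ProperBelow D n f → ProperColouring n D c (f ∘ toℕ)
ProperBelow⇒ProperColouring {D = D} proper i j (i≢j , dist∈D) with <-cmp (toℕ i) (toℕ j)
... | tri< i<j _ _ = proper i<j (Fin.toℕ<n j) (subst (_∈ D) (m≤n⇒∣m-n∣≡n∸m (<⇒≤ i<j)) dist∈D)
... | tri≈ _ i≡j _ = ⊥-elim (i≢j i≡j)
... | tri> _ _ j<i = proper j<i (Fin.toℕ<n i) i∸j∈D ∘ sym
  where
  i∸j∈D : toℕ i ∸ toℕ j ∈ D
  i∸j∈D = subst (_∈ D) (trans (∣-∣-comm (toℕ i) (toℕ j)) (m≤n⇒∣m-n∣≡n∸m (<⇒≤ j<i))) dist∈D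

colourable-suc-length : ∀ n D → Colourable n D (suc (length D))
colourable-suc-length n D =
  let f , proper = greedyColouring D n in f ∘ toℕ , ProperBelow⇒ProperColouring proper

Adj⁺ : ∀ {n D} {i j : Fin n} → toℕ i < toℕ j → toℕ j ∸ toℕ i ∈ D → Adj D i j
Adj⁺ {D = D} i<j j∸i∈D = <⇒≢ i<j , subst (_∈ D) (sym (m≤n⇒∣m-n∣≡n∸m (<⇒≤ i<j))) j∸i∈D

clique⇒¬Colourable : ∀ {n D q c} (v : Fin q → Fin n) →
                     (∀ {a b} → a Fin.< b → Adj D (v a) (v b)) → c < q → ¬ Colourable n D c
clique⇒¬Colourable v adjacent c<q (f , proper) =
  let a , b , a<b , same = Fin.pigeonhole c<q (f ∘ v) in proper (v a) (v b) (adjacent a<b) same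

initialSegment⇒¬Colourable : ∀ {n D q c} → q ≤ n → (∀ {d} → 0 < d → d < q → d ∈ D) →
                             c < q → ¬ Colourable n D c
initialSegment⇒¬Colourable {D = D} q≤n segment⊆D =
  clique⇒¬Colourable (λ a → inject≤ a q≤n) adjacent
  where
  adjacent : ∀ {a b} → a Fin.< b → Adj D (inject≤ a q≤n) (inject≤ b q≤n)
  adjacent {a} {b} a<b = Adj⁺ (subst₂ _<_ (sym ta) (sym tb) a<b)
    (subst (_∈ D) (sym (cong₂ _∸_ tb ta))
      (segment⊆D (m<n⇒0<n∸m a<b) (≤-<-trans (m∸n≤m (toℕ b) (toℕ a)) (Fin.toℕ<n b))))
    where
    ta : toℕ (inject≤ a q≤n) ≡ toℕ a
    ta = Fin.toℕ-inject≤ a q≤n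
    tb : toℕ (inject≤ b q≤n) ≡ toℕ b
    tb = Fin.toℕ-inject≤ b q≤n

edge⇒2≤colours : ∀ {n D d c} → d ∈ D → 0 < d → d ≤ n ∸ 1 → Colourable n D c → 2 ≤ c
edge⇒2≤colours {zero} {d = suc _} _ _ ()
edge⇒2≤colours {suc n} {D} {d} d∈D 0<d d≤n colourable =
  ≮⇒≥ λ c<2 → clique⇒¬Colourable endpoints adjacent c<2 colourable
  where
  endpoints : Fin 2 → Fin (suc n)
  endpoints Fin.zero    = Fin.zero
  endpoints (Fin.suc _) = fromℕ< (s≤s d≤n)
  adjacent : ∀ {a b} → a Fin.< b → Adj D (endpoints a) (endpoints b)
  adjacent {Fin.zero} {Fin.suc Fin.zero} _ =
    Adj⁺ (subst (0 <_) (sym td) 0<d) (subst (_∈ D) (sym td) d∈D)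
    where
    td : toℕ (fromℕ< (s≤s d≤n)) ≡ d
    td = Fin.toℕ-fromℕ< (s≤s d≤n)
  adjacent {Fin.suc Fin.zero} {Fin.suc Fin.zero} (s≤s ())

%-≡⇒∣∸ : ∀ q .{{_ : NonZero q}} a b → a % q ≡ b % q → q ∣ a ∸ b
%-≡⇒∣∸ q a b a≡b = divides (a / q ∸ b / q) (begin
  a ∸ b                                       ≡⟨ cong₂ _∸_ (m≡m%n+[m/n]*n a q) (m≡m%n+[m/n]*n b q) ⟩
  (a % q + a / q * q) ∸ (b % q + b / q * q)   ≡⟨ cong (λ r → (a % q + a / q * q) ∸ (r + b / q * q)) a≡b ⟨
  (a % q + a / q * q) ∸ (a % q + b / q * q)   ≡⟨ [m+n]∸[m+o]≡n∸o (a % q) (a / q * q) (b / q * q) ⟩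
  a / q * q ∸ b / q * q                       ≡⟨ *-distribʳ-∸ q (a / q) (b / q) ⟨
  (a / q ∸ b / q) * q                         ∎)
  where open ≡-Reasoning

%-≡⇒∣∣-∣ : ∀ q .{{_ : NonZero q}} a b → a % q ≡ b % q → q ∣ ∣ a - b ∣
%-≡⇒∣∣-∣ q a b a≡b with ∣m-n∣≡[m∸n]∨[n∸m] a b
... | inj₁ eq = subst (q ∣_) (sym eq) (%-≡⇒∣∸ q a b a≡b)
... | inj₂ eq = subst (q ∣_) (sym eq) (%-≡⇒∣∸ q b a (sym a≡b))

residueColouring : ∀ n q .{{_ : NonZero q}} D → (∀ {d} → d ∈ D → q ∤ d) → Colourable n D q
residueColouring n q D q∤D = colour , proper
  where
  colour : Fin n → Fin q
  colour i = fromℕ< (m%n<n (toℕ i) q)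
  proper : ProperColouring n D q colour
  proper i j (_ , dist∈D) same = q∤D dist∈D (%-≡⇒∣∣-∣ q (toℕ i) (toℕ j)
    (trans (sym (Fin.toℕ-fromℕ< _)) (trans (cong toℕ same) (Fin.toℕ-fromℕ< _))))

-- The (j + 1)-th positive integer not divisible by p + 2: every block of p + 1 such integers
-- is followed by one skipped multiple of p + 2.
nonMultiple : ℕ → ℕ → ℕ
nonMultiple p j = suc (j + j / suc p)

nonMultiple-divMod : ∀ p j → nonMultiple p j ≡ j / suc p * suc (suc p) + suc (j % suc p)
nonMultiple-divMod p j = begin
  suc (j + j / suc p)
    ≡⟨ cong (λ x → suc (x + j / suc p)) (m≡m%n+[m/n]*n j (suc p)) ⟩
  suc (j % suc p + j / suc p * suc p + j / suc p)
    ≡⟨ rearrange (j % suc p) (j / suc p) (suc p) ⟩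
  j / suc p * suc (suc p) + suc (j % suc p)
    ∎
  where
  open ≡-Reasoning
  open +-*-Solver
  rearrange : ∀ r q s → suc (r + q * s + q) ≡ q * suc s + suc r
  rearrange = solve 3 (λ r q s → con 1 :+ (r :+ q :* s :+ q) := q :* (con 1 :+ s) :+ (con 1 :+ r))
                      refl

∤-nonMultiple : ∀ p j → suc (suc p) ∤ nonMultiple p j
∤-nonMultiple p j divides-nonMultiple =
  n≮n (suc p) (≤-trans (∣⇒≤ divides-remainder) (m%n<n j (suc p)))
  where
  divides-remainder : suc (suc p) ∣ suc (j % suc p)
  divides-remainder = ∣m+n∣m⇒∣n (subst (suc (suc p) ∣_) (nonMultiple-divMod p j) divides-nonMultiple)
                                (n∣m*n (j / suc p))

nonMultiple-mono-< : ∀ p {a b} → a < b → nonMultiple p a < nonMultiple p b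
nonMultiple-mono-< p a<b = s≤s (+-mono-<-≤ a<b (/-monoˡ-≤ (suc p) (<⇒≤ a<b)))

nonMultiple-small : ∀ p {j} → j < suc p → nonMultiple p j ≡ suc j
nonMultiple-small p {j} j<1+p rewrite m<n⇒m/n≡0 j<1+p = cong suc (+-identityʳ j)

nonMultiple-≤ : ∀ p j → nonMultiple p j ≤ suc (j + j)
nonMultiple-≤ p j = s≤s (+-monoʳ-≤ j (m/n≤m j (suc p)))

nonMultiples : ℕ → ℕ → List ℕ
nonMultiples p k = applyUpTo (nonMultiple p) k

nonMultiples-admissible : ∀ {n} p k → k + k ≤ n → AdmissibleDistanceSet n k (nonMultiples p k)
nonMultiples-admissible {n} p k 2k≤n =
  Unique.applyUpTo⁺₁ (nonMultiple p) k (λ i<j _ → <⇒≢ (nonMultiple-mono-< p i<j)) ,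
  length-applyUpTo (nonMultiple p) k ,
  All.applyUpTo⁺₁ (nonMultiple p) k (λ j<k → z<s , <⇒≤∸1 (nonMultiple<n j<k))
  where
  <⇒≤∸1 : ∀ {d} → d < n → d ≤ n ∸ 1
  <⇒≤∸1 {d} d<n = subst (d ≤_) (pred[m∸n]≡m∸[1+n] n 0) (suc[m]≤n⇒m≤pred[n] d<n)
  nonMultiple<n : ∀ {j} → j < k → nonMultiple p j < n
  nonMultiple<n {j} j<k = ≤-<-trans (nonMultiple-≤ p j)
    (<-≤-trans (subst (_≤ k + k) (cong suc (+-suc j j)) (+-mono-≤ j<k j<k)) 2k≤n)

initialSegment⊆nonMultiples : ∀ p k → suc p ≤ k →
                              ∀ {d} → 0 < d → d < suc (suc p) → d ∈ nonMultiples p k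
initialSegment⊆nonMultiples p k 1+p≤k {suc e} _ (s≤s e<1+p) =
  subst (_∈ nonMultiples p k) (nonMultiple-small p e<1+p)
        (∈-applyUpTo⁺ (nonMultiple p) (<-≤-trans e<1+p 1+p≤k))

∤-nonMultiples : ∀ p k {d} → d ∈ nonMultiples p k → suc (suc p) ∤ d
∤-nonMultiples p k d∈D with ∈-applyUpTo⁻ (nonMultiple p) d∈D
... | j , _ , refl = ∤-nonMultiple p j

nonMultiples-chromaticNumber : ∀ n p k → suc (suc p) ≤ n → suc p ≤ k →
                               IsChromaticNumber n (nonMultiples p k) (suc (suc p))
nonMultiples-chromaticNumber n p k q≤n 1+p≤k =
  residueColouring n (suc (suc p)) (nonMultiples p k) (∤-nonMultiples p k) ,
  λ _ → initialSegment⇒¬Colourable q≤n (initialSegment⊆nonMultiples p k 1+p≤k)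

chromaticNumber≤suc-length : ∀ {n D m} → IsChromaticNumber n D m → m ≤ suc (length D)
chromaticNumber≤suc-length {n} {D} (_ , minimal) =
  ≮⇒≥ λ suc-length<m → minimal (suc (length D)) suc-length<m (colourable-suc-length n D)

admissible⇒2≤chromaticNumber : ∀ {n k D m} → 0 < k → AdmissibleDistanceSet n k D →
                               IsChromaticNumber n D m → 2 ≤ m
admissible⇒2≤chromaticNumber {D = []} () (_ , refl , _)
admissible⇒2≤chromaticNumber {D = d ∷ _} _ (_ , _ , (0<d , d≤n∸1) ∷ _) (colourable , _) =
  edge⇒2≤colours (here refl) 0<d d≤n∸1 colourable

m≤⌊n/2⌋⇒m+m≤n : ∀ {m n} → m ≤ ⌊ n /2⌋ → m + m ≤ n
m≤⌊n/2⌋⇒m+m≤n {n = n} m≤⌊n/2⌋ = ≤-trans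
  (+-mono-≤ m≤⌊n/2⌋ (≤-trans m≤⌊n/2⌋ (⌊n/2⌋≤⌈n/2⌉ n)))
  (≤-reflexive (⌊n/2⌋+⌈n/2⌉≡n n))

theorem2p2 : (n k : ℕ) → 1 ≤ k → k + 1 ≤ n → k ≤ ⌊ n /2⌋ →
    (m : ℕ) → InSpec n k m ⇔ (2 ≤ m × m ≤ k + 1)
theorem2p2 n k 0<k k+1≤n k≤⌊n/2⌋ m = mk⇔ spec⇒bounds bounds⇒spec
  where
  spec⇒bounds : InSpec n k m → 2 ≤ m × m ≤ k + 1
  spec⇒bounds (D , admissible@(_ , length≡k , _) , χ) =
    admissible⇒2≤chromaticNumber 0<k admissible χ ,
    subst (m ≤_) (trans (cong suc length≡k) (+-comm 1 k)) (chromaticNumber≤suc-length χ)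
  bounds⇒spec : 2 ≤ m × m ≤ k + 1 → InSpec n k m
  bounds⇒spec (s≤s (s≤s {n = p} _) , m≤k+1) =
    nonMultiples p k ,
    nonMultiples-admissible p k (m≤⌊n/2⌋⇒m+m≤n k≤⌊n/2⌋) ,
    nonMultiples-chromaticNumber n p k (≤-trans m≤k+1 k+1≤n)
      (s≤s⁻¹ (subst (m ≤_) (+-comm k 1) m≤k+1))
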